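{- Let $f_1(X),f_2(X)\in\mathbb{F}_q[X]$ be nonconstant squarefree polynomials coprime to $X$. If both $f_1$ and $f_2$ are free of binomials, then so is $\mathrm{lcm}(f_1,f_2)$.
   Context: The order $\mathrm{ord}(g)$ is the least positive $m$ with $g\mid X^m-1$. A binomial is $X^n-\lambda$, $n\ge1$, $\lambda\in\mathbb{F}_q^\ast$. A polynomial $g$ is free of binomials if it divides no binomial over $\mathbb{F}_q$ of degree less than $\mathrm{ord}(g)$. -}

module Defs where

open import Level using (Level; _⊔_; suc)
open import Algebra.Bundles using (CommutativeRing)
open import Data.Nat using (ℕ; zero; _≤_; _<_) renaming (suc to sucℕ)
open import Data.Fin using (Fin)
open import Data.List using (List; []; _∷_)
open import Data.List.Relation.Unary.All using (All)
open import Data.Product using (Σ; ∃; _×_; _,_)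
open import Relation.Nullary using (¬_)
open import Relation.Binary.Definitions using (Decidable)

record FiniteField (c ℓ : Level) : Set (suc (c ⊔ ℓ)) where
  field
    commutativeRing : CommutativeRing c ℓ
  open CommutativeRing commutativeRing public
  field
    0≉1      : ¬ (0# ≈ 1#)
    inverse  : ∀ x → ¬ (x ≈ 0#) → ∃ λ y → x * y ≈ 1#
    _≟_      : Decidable _≈_
    size     : ℕ
    enum     : Fin size → Carrier
    enum-onto : ∀ x → ∃ λ i → enum i ≈ x

-- Univariate polynomials over F, as coefficient lists (constant term first);
-- equality is equality of coefficients up to trailing zeros.
module Poly {c ℓ : Level} (F : FiniteField c ℓ) where
  open FiniteField F

  Pol : Set c
  Pol = List Carrier

  _+ₚ_ : Pol → Pol → Pol
  []       +ₚ q        = q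
  (a ∷ p)  +ₚ []       = a ∷ p
  (a ∷ p)  +ₚ (b ∷ q)  = (a + b) ∷ (p +ₚ q)

  -ₚ_ : Pol → Pol
  -ₚ []      = []
  -ₚ (a ∷ p) = (- a) ∷ (-ₚ p)

  _-ₚ_ : Pol → Pol → Pol
  p -ₚ q = p +ₚ (-ₚ q)

  _·ₚ_ : Carrier → Pol → Pol
  a ·ₚ []      = []
  a ·ₚ (b ∷ q) = (a * b) ∷ (a ·ₚ q)

  _*ₚ_ : Pol → Pol → Pol
  []      *ₚ q = []
  (a ∷ p) *ₚ q = (a ·ₚ q) +ₚ (0# ∷ (p *ₚ q))

  _≈ₚ_ : Pol → Pol → Set (c ⊔ ℓ)
  p ≈ₚ q = All (_≈ 0#) (p -ₚ q)

  const : Carrier → Pol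
  const a = a ∷ []

  oneₚ : Pol
  oneₚ = const 1#

  X : Pol
  X = 0# ∷ 1# ∷ []

  X^ : ℕ → Pol
  X^ zero     = oneₚ
  X^ (sucℕ n) = X *ₚ X^ n

  binomial : ℕ → Carrier → Pol
  binomial n λ′ = X^ n -ₚ const λ′

  _∣ₚ_ : Pol → Pol → Set (c ⊔ ℓ)
  g ∣ₚ h = ∃ λ k → (g *ₚ k) ≈ₚ h

  IsConstant : Pol → Set (c ⊔ ℓ)
  IsConstant p = ∃ λ a → p ≈ₚ const a

  NonConstant : Pol → Set (c ⊔ ℓ)
  NonConstant p = ¬ IsConstant p

  IsUnit : Pol → Set (c ⊔ ℓ)
  IsUnit p = ∃ λ k → (p *ₚ k) ≈ₚ oneₚ

  Squarefree : Pol → Set (c ⊔ ℓ)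
  Squarefree f = ∀ g → (g *ₚ g) ∣ₚ f → IsUnit g

  Coprime : Pol → Pol → Set (c ⊔ ℓ)
  Coprime f g = ∀ d → d ∣ₚ f → d ∣ₚ g → IsUnit d

  IsLCM : Pol → Pol → Pol → Set (c ⊔ ℓ)
  IsLCM f₁ f₂ l = f₁ ∣ₚ l × f₂ ∣ₚ l × (∀ m → f₁ ∣ₚ m → f₂ ∣ₚ m → l ∣ₚ m)

  IsOrder : Pol → ℕ → Set (c ⊔ ℓ)
  IsOrder g m = 1 ≤ m × g ∣ₚ binomial m 1#
              × (∀ k → 1 ≤ k → g ∣ₚ binomial k 1# → m ≤ k)

  FreeOfBinomials : Pol → Set (c ⊔ ℓ)
  FreeOfBinomials g = ∀ m → IsOrder g m →
    ∀ n λ′ → 1 ≤ n → n < m → ¬ (λ′ ≈ 0#) → ¬ (g ∣ₚ binomial n λ′)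

module Submission where

-- Only f₁ matters: a multiple l of a nonconstant binomial-free f is binomial-free.  Suppose l ∣ X^n − λ
-- with 1 ≤ n < ord l and λ ≠ 0.  Then λ ≠ 1 by minimality of ord l, and f ∣ X^n − λ.
-- With e = ord f, X^(e+r) − λ = (X^e − 1)·X^r + (X^r − λ) lets n be reduced by e
-- while keeping f ∣ X^n − λ; as f divides no binomial of degree in [1, e), this only
-- stops at n = 0, so f divides the nonzero constant 1 − λ and is constant.  The
-- order of f exists only under double negation, which suffices as the goal is ⊥.

open import Defs
open import Data.Empty using (⊥-elim)
open import Data.List using ([]; _∷_)
open import Data.List.Relation.Unary.All using (All; []; _∷_)
open import Data.Maybe using (nothing)
open import Data.Nat as ℕ using (ℕ; zero; suc; _≤_; _<_; z≤n; s≤s)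
open import Data.Nat.Induction using (<-rec)
open import Data.Nat.Properties using (≮⇒≥; <⇒≤; <⇒≱; ≤-trans; m≤n+m; m<n+m; _<?_; m≤n⇒∃[o]m+o≡n)
open import Data.Product using (_×_; _,_; ∃; ∃₂; proj₁; proj₂)
open import Data.Sum using (_⊎_; inj₁; inj₂)
open import Relation.Binary.Bundles using (Setoid)
import Relation.Binary.PropositionalEquality as ≡
import Relation.Binary.Reasoning.Setoid as SetoidReasoning
open import Relation.Nullary using (¬_; yes; no)
open import Relation.Nullary.Negation using (¬¬-map)
open import Relation.Nullary.Decidable using (¬¬-excluded-middle)
import Tactic.RingSolver.Core.AlmostCommutativeRing as ACR
import Tactic.RingSolver.NonReflective as RingSolver

Least : ∀ {p} → (ℕ → Set p) → Set p
Least P = ∃ λ e → P e × ∀ k → P k → e ≤ k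

¬¬-least : ∀ {p} (P : ℕ → Set p) {w} → P w → ¬ ¬ Least P
¬¬-least P {w} = <-rec (λ w → P w → ¬ ¬ Least P) step w
  where
  step : ∀ w → (∀ {v} → v < w → P v → ¬ ¬ Least P) → P w → ¬ ¬ Least P
  step w rec pw ¬least = ¬¬-excluded-middle {A = ∃ λ v → v < w × P v} λ
    { (yes (v , v<w , pv)) → rec v<w pv ¬least
    ; (no ¬smaller)        →
        ¬least (w , pw , λ k pk → ≮⇒≥ λ k<w → ¬smaller (k , k<w , pk)) }

module Polynomials {c ℓ} (F : FiniteField c ℓ) where
  open FiniteField F hiding (zero)
  open Poly F
  open import Algebra.Properties.Group +-group using (ε⁻¹≈ε; x∙y⁻¹≈ε⇒x≈y; x≈y⇒x∙y⁻¹≈ε)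
  open import Algebra.Properties.Ring ring using (-‿distribʳ-*; -1*x≈-x)
  open import Algebra.Properties.AbelianGroup +-abelianGroup using (⁻¹-∙-comm; ⁻¹-anti-homo‿-)
  open RingSolver (ACR.fromCommutativeRing commutativeRing (λ _ → nothing))
  module ≈-Reasoning = SetoidReasoning setoid

  *-nonzero : ∀ {x y} → ¬ x ≈ 0# → ¬ y ≈ 0# → ¬ x * y ≈ 0#
  *-nonzero {x} {y} x≉0 y≉0 xy≈0 with inverse x x≉0
  ... | x⁻¹ , xx⁻¹≈1 = y≉0 (begin
    y                ≈⟨ *-identityˡ y ⟨
    1# * y           ≈⟨ *-congʳ xx⁻¹≈1 ⟨
    (x * x⁻¹) * y    ≈⟨ *-congʳ (*-comm x x⁻¹) ⟩
    (x⁻¹ * x) * y    ≈⟨ *-assoc x⁻¹ x y ⟩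
    x⁻¹ * (x * y)    ≈⟨ *-congˡ xy≈0 ⟩
    x⁻¹ * 0#         ≈⟨ zeroʳ x⁻¹ ⟩
    0#               ∎)
    where open ≈-Reasoning

  [y+l]-[y-z]≈z+l : ∀ y l z → (y + l) - (y - z) ≈ z + l
  [y+l]-[y-z]≈z+l y l z = begin
    (y + l) - (y - z)       ≈⟨ +-congˡ (⁻¹-anti-homo‿- y z) ⟩
    -- with - y abstracted to a variable the step is a semiring identity
    (y + l) + (z - y)       ≈⟨ solve 4 (λ y l z w → ((y ⊕ l) ⊕ (z ⊕ w)) ⊜ ((y ⊕ w) ⊕ (z ⊕ l))) refl y l z (- y) ⟩
    (y - y) + (z + l)       ≈⟨ +-congʳ (-‿inverseʳ y) ⟩
    0# + (z + l)            ≈⟨ +-identityˡ _ ⟩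
    z + l                   ∎
    where open ≈-Reasoning

  coeff : Pol → ℕ → Carrier
  coeff []      _       = 0#
  coeff (a ∷ p) zero    = a
  coeff (a ∷ p) (suc i) = coeff p i

  -- Equivalent to _≈ₚ_ (≈ₚ⇒≋, ≋⇒≈ₚ), but pointwise, so that polynomial laws can be
  -- proved coefficient by coefficient.
  infix 4 _≋_
  record _≋_ (p q : Pol) : Set ℓ where
    constructor coeffwise
    field coeff-≈ : ∀ i → coeff p i ≈ coeff q i
  open _≋_

  ≋-refl : ∀ {p} → p ≋ p
  ≋-refl = coeffwise λ _ → refl

  ≋-sym : ∀ {p q} → p ≋ q → q ≋ p
  ≋-sym p≋q = coeffwise λ i → sym (coeff-≈ p≋q i)

  ≋-trans : ∀ {p q r} → p ≋ q → q ≋ r → p ≋ r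
  ≋-trans p≋q q≋r = coeffwise λ i → trans (coeff-≈ p≋q i) (coeff-≈ q≋r i)

  ≋-setoid : Setoid c ℓ
  ≋-setoid = record
    { Carrier       = Pol
    ; _≈_           = _≋_
    ; isEquivalence = record { refl = ≋-refl ; sym = ≋-sym ; trans = ≋-trans }
    }

  module ≋-Reasoning = SetoidReasoning ≋-setoid

  All≈0⇒coeff≈0 : ∀ {r} → All (_≈ 0#) r → ∀ i → coeff r i ≈ 0#
  All≈0⇒coeff≈0 []          _       = refl
  All≈0⇒coeff≈0 (a≈0 ∷ _)   zero    = a≈0
  All≈0⇒coeff≈0 (_ ∷ r≈0)   (suc i) = All≈0⇒coeff≈0 r≈0 i

  coeff≈0⇒All≈0 : ∀ r → (∀ i → coeff r i ≈ 0#) → All (_≈ 0#) r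
  coeff≈0⇒All≈0 []      _   = []
  coeff≈0⇒All≈0 (a ∷ r) r≈0 = r≈0 zero ∷ coeff≈0⇒All≈0 r (λ i → r≈0 (suc i))

  coeff-+ₚ : ∀ p q i → coeff (p +ₚ q) i ≈ coeff p i + coeff q i
  coeff-+ₚ []      q       i       = sym (+-identityˡ _)
  coeff-+ₚ (a ∷ p) []      i       = sym (+-identityʳ _)
  coeff-+ₚ (a ∷ p) (b ∷ q) zero    = refl
  coeff-+ₚ (a ∷ p) (b ∷ q) (suc i) = coeff-+ₚ p q i

  coeff-neg : ∀ p i → coeff (-ₚ p) i ≈ - coeff p i
  coeff-neg []      i       = sym ε⁻¹≈ε
  coeff-neg (a ∷ p) zero    = refl
  coeff-neg (a ∷ p) (suc i) = coeff-neg p i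

  coeff--ₚ : ∀ p q i → coeff (p -ₚ q) i ≈ coeff p i - coeff q i
  coeff--ₚ p q i = trans (coeff-+ₚ p (-ₚ q) i) (+-congˡ (coeff-neg q i))

  coeff-·ₚ : ∀ a p i → coeff (a ·ₚ p) i ≈ a * coeff p i
  coeff-·ₚ a []      i       = sym (zeroʳ a)
  coeff-·ₚ a (b ∷ p) zero    = refl
  coeff-·ₚ a (b ∷ p) (suc i) = coeff-·ₚ a p i

  coeff-∷*ₚ-zero : ∀ a p q → coeff ((a ∷ p) *ₚ q) 0 ≈ a * coeff q 0
  coeff-∷*ₚ-zero a p q =
    trans (coeff-+ₚ (a ·ₚ q) _ 0) (trans (+-identityʳ _) (coeff-·ₚ a q 0))

  coeff-∷*ₚ-suc : ∀ a p q i →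
                  coeff ((a ∷ p) *ₚ q) (suc i) ≈ a * coeff q (suc i) + coeff (p *ₚ q) i
  coeff-∷*ₚ-suc a p q i = trans (coeff-+ₚ (a ·ₚ q) _ (suc i)) (+-congʳ (coeff-·ₚ a q (suc i)))

  ≈ₚ⇒≋ : ∀ {p q} → p ≈ₚ q → p ≋ q
  ≈ₚ⇒≋ {p} {q} p-q≈0 = coeffwise λ i →
    x∙y⁻¹≈ε⇒x≈y _ _ (trans (sym (coeff--ₚ p q i)) (All≈0⇒coeff≈0 p-q≈0 i))

  ≋⇒≈ₚ : ∀ {p q} → p ≋ q → p ≈ₚ q
  ≋⇒≈ₚ {p} {q} p≋q = coeff≈0⇒All≈0 _ λ i →
    trans (coeff--ₚ p q i) (x≈y⇒x∙y⁻¹≈ε (coeff-≈ p≋q i))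

  ∷-cong : ∀ {a b p q} → a ≈ b → p ≋ q → a ∷ p ≋ b ∷ q
  ∷-cong a≈b p≋q = coeffwise λ { zero → a≈b ; (suc i) → coeff-≈ p≋q i }

  ∷-tail : ∀ {a b p q} → a ∷ p ≋ b ∷ q → p ≋ q
  ∷-tail a∷p≋b∷q = coeffwise λ i → coeff-≈ a∷p≋b∷q (suc i)

  ∷≋[]⇒≋[] : ∀ {a p} → a ∷ p ≋ [] → p ≋ []
  ∷≋[]⇒≋[] a∷p≋[] = coeffwise λ i → coeff-≈ a∷p≋[] (suc i)

  0∷≋[] : ∀ {p} → p ≋ [] → 0# ∷ p ≋ []
  0∷≋[] p≋[] = coeffwise λ { zero → refl ; (suc i) → coeff-≈ p≋[] i }

  +ₚ-cong : ∀ {p p′ q q′} → p ≋ p′ → q ≋ q′ → p +ₚ q ≋ p′ +ₚ q′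
  +ₚ-cong {p} {p′} {q} {q′} p≋p′ q≋q′ = coeffwise λ i → begin
    coeff (p +ₚ q) i        ≈⟨ coeff-+ₚ p q i ⟩
    coeff p i + coeff q i   ≈⟨ +-cong (coeff-≈ p≋p′ i) (coeff-≈ q≋q′ i) ⟩
    coeff p′ i + coeff q′ i ≈⟨ coeff-+ₚ p′ q′ i ⟨
    coeff (p′ +ₚ q′) i      ∎
    where open ≈-Reasoning

  -ₚ-cong : ∀ {p q} → p ≋ q → -ₚ p ≋ -ₚ q
  -ₚ-cong {p} {q} p≋q = coeffwise λ i →
    trans (coeff-neg p i) (trans (-‿cong (coeff-≈ p≋q i)) (sym (coeff-neg q i)))

  *ₚ-zeroˡ : ∀ p q → p ≋ [] → p *ₚ q ≋ []
  *ₚ-zeroˡ []      q _       = ≋-refl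
  *ₚ-zeroˡ (a ∷ p) q a∷p≋[] = coeffwise λ
    { zero    → trans (coeff-∷*ₚ-zero a p q) (a*x≈0 0)
    ; (suc i) → begin
        coeff ((a ∷ p) *ₚ q) (suc i)           ≈⟨ coeff-∷*ₚ-suc a p q i ⟩
        a * coeff q (suc i) + coeff (p *ₚ q) i ≈⟨ +-cong (a*x≈0 (suc i)) (coeff-≈ p*q≋[] i) ⟩
        0# + 0#                                ≈⟨ +-identityˡ 0# ⟩
        0#                                     ∎ }
    where
    open ≈-Reasoning
    a*x≈0 : ∀ i → a * coeff q i ≈ 0#
    a*x≈0 i = trans (*-congʳ (coeff-≈ a∷p≋[] 0)) (zeroˡ _)
    p*q≋[] : p *ₚ q ≋ []
    p*q≋[] = *ₚ-zeroˡ p q (∷≋[]⇒≋[] a∷p≋[])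

  *ₚ-zeroʳ : ∀ p → p *ₚ [] ≋ []
  *ₚ-zeroʳ []      = ≋-refl
  *ₚ-zeroʳ (a ∷ p) = 0∷≋[] (*ₚ-zeroʳ p)

  *ₚ-congˡ : ∀ p p′ q → p ≋ p′ → p *ₚ q ≋ p′ *ₚ q
  *ₚ-congˡ []      p′        q p≋p′ = ≋-sym (*ₚ-zeroˡ p′ q (≋-sym p≋p′))
  *ₚ-congˡ (a ∷ p) []        q p≋p′ = *ₚ-zeroˡ (a ∷ p) q p≋p′
  *ₚ-congˡ (a ∷ p) (a′ ∷ p′) q p≋p′ = coeffwise λ
    { zero    → trans (coeff-∷*ₚ-zero a p q)
                  (trans (*-congʳ a≈a′) (sym (coeff-∷*ₚ-zero a′ p′ q)))
    ; (suc i) → trans (coeff-∷*ₚ-suc a p q i)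
                  (trans (+-cong (*-congʳ a≈a′) (coeff-≈ (*ₚ-congˡ p p′ q (∷-tail p≋p′)) i))
                         (sym (coeff-∷*ₚ-suc a′ p′ q i))) }
    where
    a≈a′ : a ≈ a′
    a≈a′ = coeff-≈ p≋p′ 0

  *ₚ-congʳ : ∀ p q q′ → q ≋ q′ → p *ₚ q ≋ p *ₚ q′
  *ₚ-congʳ []      q q′ q≋q′ = ≋-refl
  *ₚ-congʳ (a ∷ p) q q′ q≋q′ = coeffwise λ
    { zero    → trans (coeff-∷*ₚ-zero a p q)
                  (trans (*-congˡ (coeff-≈ q≋q′ 0)) (sym (coeff-∷*ₚ-zero a p q′)))
    ; (suc i) → trans (coeff-∷*ₚ-suc a p q i)
                  (trans (+-cong (*-congˡ (coeff-≈ q≋q′ (suc i))) (coeff-≈ (*ₚ-congʳ p q q′ q≋q′) i))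
                         (sym (coeff-∷*ₚ-suc a p q′ i))) }

  +ₚ-identityʳ : ∀ p → p +ₚ [] ≋ p
  +ₚ-identityʳ p = coeffwise λ i → trans (coeff-+ₚ p [] i) (+-identityʳ _)

  *ₚ-distribʳ : ∀ p q r → (p +ₚ q) *ₚ r ≋ (p *ₚ r) +ₚ (q *ₚ r)
  *ₚ-distribʳ []      q       r = ≋-refl
  *ₚ-distribʳ (a ∷ p) []      r = ≋-sym (+ₚ-identityʳ _)
  *ₚ-distribʳ (a ∷ p) (b ∷ q) r = coeffwise λ
    { zero → begin
        coeff (((a + b) ∷ (p +ₚ q)) *ₚ r) 0                ≈⟨ coeff-∷*ₚ-zero (a + b) (p +ₚ q) r ⟩
        (a + b) * coeff r 0                                ≈⟨ distribʳ _ a b ⟩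
        a * coeff r 0 + b * coeff r 0                      ≈⟨ +-cong (coeff-∷*ₚ-zero a p r) (coeff-∷*ₚ-zero b q r) ⟨
        coeff ((a ∷ p) *ₚ r) 0 + coeff ((b ∷ q) *ₚ r) 0    ≈⟨ coeff-+ₚ ((a ∷ p) *ₚ r) _ 0 ⟨
        coeff (((a ∷ p) *ₚ r) +ₚ ((b ∷ q) *ₚ r)) 0         ∎
    ; (suc i) → begin
        coeff (((a + b) ∷ (p +ₚ q)) *ₚ r) (suc i)
          ≈⟨ coeff-∷*ₚ-suc (a + b) (p +ₚ q) r i ⟩
        (a + b) * coeff r (suc i) + coeff ((p +ₚ q) *ₚ r) i
          ≈⟨ +-congˡ (trans (coeff-≈ (*ₚ-distribʳ p q r) i) (coeff-+ₚ (p *ₚ r) _ i)) ⟩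
        (a + b) * coeff r (suc i) + (coeff (p *ₚ r) i + coeff (q *ₚ r) i)
          ≈⟨ solve 5 (λ a b x s t → ((a ⊕ b) ⊗ x ⊕ (s ⊕ t)) ⊜ ((a ⊗ x ⊕ s) ⊕ (b ⊗ x ⊕ t))) refl
                     a b (coeff r (suc i)) _ _ ⟩
        (a * coeff r (suc i) + coeff (p *ₚ r) i) + (b * coeff r (suc i) + coeff (q *ₚ r) i)
          ≈⟨ +-cong (coeff-∷*ₚ-suc a p r i) (coeff-∷*ₚ-suc b q r i) ⟨
        coeff ((a ∷ p) *ₚ r) (suc i) + coeff ((b ∷ q) *ₚ r) (suc i)
          ≈⟨ coeff-+ₚ ((a ∷ p) *ₚ r) _ (suc i) ⟨
        coeff (((a ∷ p) *ₚ r) +ₚ ((b ∷ q) *ₚ r)) (suc i)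
          ∎ }
    where open ≈-Reasoning

  *ₚ-distribˡ : ∀ p q r → p *ₚ (q +ₚ r) ≋ (p *ₚ q) +ₚ (p *ₚ r)
  *ₚ-distribˡ []      q r = ≋-refl
  *ₚ-distribˡ (a ∷ p) q r = coeffwise λ
    { zero → begin
        coeff ((a ∷ p) *ₚ (q +ₚ r)) 0                      ≈⟨ coeff-∷*ₚ-zero a p (q +ₚ r) ⟩
        a * coeff (q +ₚ r) 0                               ≈⟨ *-congˡ (coeff-+ₚ q r 0) ⟩
        a * (coeff q 0 + coeff r 0)                        ≈⟨ distribˡ a _ _ ⟩
        a * coeff q 0 + a * coeff r 0                      ≈⟨ +-cong (coeff-∷*ₚ-zero a p q) (coeff-∷*ₚ-zero a p r) ⟨
        coeff ((a ∷ p) *ₚ q) 0 + coeff ((a ∷ p) *ₚ r) 0    ≈⟨ coeff-+ₚ ((a ∷ p) *ₚ q) _ 0 ⟨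
        coeff (((a ∷ p) *ₚ q) +ₚ ((a ∷ p) *ₚ r)) 0         ∎
    ; (suc i) → begin
        coeff ((a ∷ p) *ₚ (q +ₚ r)) (suc i)
          ≈⟨ coeff-∷*ₚ-suc a p (q +ₚ r) i ⟩
        a * coeff (q +ₚ r) (suc i) + coeff (p *ₚ (q +ₚ r)) i
          ≈⟨ +-cong (*-congˡ (coeff-+ₚ q r (suc i)))
                    (trans (coeff-≈ (*ₚ-distribˡ p q r) i) (coeff-+ₚ (p *ₚ q) _ i)) ⟩
        a * (coeff q (suc i) + coeff r (suc i)) + (coeff (p *ₚ q) i + coeff (p *ₚ r) i)
          ≈⟨ solve 5 (λ a x y s t → (a ⊗ (x ⊕ y) ⊕ (s ⊕ t)) ⊜ ((a ⊗ x ⊕ s) ⊕ (a ⊗ y ⊕ t))) refl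
                     a (coeff q (suc i)) (coeff r (suc i)) _ _ ⟩
        (a * coeff q (suc i) + coeff (p *ₚ q) i) + (a * coeff r (suc i) + coeff (p *ₚ r) i)
          ≈⟨ +-cong (coeff-∷*ₚ-suc a p q i) (coeff-∷*ₚ-suc a p r i) ⟨
        coeff ((a ∷ p) *ₚ q) (suc i) + coeff ((a ∷ p) *ₚ r) (suc i)
          ≈⟨ coeff-+ₚ ((a ∷ p) *ₚ q) _ (suc i) ⟨
        coeff (((a ∷ p) *ₚ q) +ₚ ((a ∷ p) *ₚ r)) (suc i)
          ∎ }
    where open ≈-Reasoning

  *ₚ-negʳ : ∀ p q → p *ₚ (-ₚ q) ≋ -ₚ (p *ₚ q)
  *ₚ-negʳ []      q = ≋-refl
  *ₚ-negʳ (a ∷ p) q = coeffwise λ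
    { zero → begin
        coeff ((a ∷ p) *ₚ (-ₚ q)) 0   ≈⟨ coeff-∷*ₚ-zero a p (-ₚ q) ⟩
        a * coeff (-ₚ q) 0            ≈⟨ *-congˡ (coeff-neg q 0) ⟩
        a * - coeff q 0               ≈⟨ -‿distribʳ-* a _ ⟨
        - (a * coeff q 0)             ≈⟨ -‿cong (coeff-∷*ₚ-zero a p q) ⟨
        - coeff ((a ∷ p) *ₚ q) 0      ≈⟨ coeff-neg ((a ∷ p) *ₚ q) 0 ⟨
        coeff (-ₚ ((a ∷ p) *ₚ q)) 0   ∎
    ; (suc i) → begin
        coeff ((a ∷ p) *ₚ (-ₚ q)) (suc i)
          ≈⟨ coeff-∷*ₚ-suc a p (-ₚ q) i ⟩
        a * coeff (-ₚ q) (suc i) + coeff (p *ₚ (-ₚ q)) i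
          ≈⟨ +-cong (*-congˡ (coeff-neg q (suc i)))
                    (trans (coeff-≈ (*ₚ-negʳ p q) i) (coeff-neg (p *ₚ q) i)) ⟩
        a * - coeff q (suc i) + - coeff (p *ₚ q) i
          ≈⟨ +-congʳ (-‿distribʳ-* a _) ⟨
        - (a * coeff q (suc i)) + - coeff (p *ₚ q) i
          ≈⟨ ⁻¹-∙-comm (a * coeff q (suc i)) _ ⟩
        - (a * coeff q (suc i) + coeff (p *ₚ q) i)
          ≈⟨ -‿cong (coeff-∷*ₚ-suc a p q i) ⟨
        - coeff ((a ∷ p) *ₚ q) (suc i)
          ≈⟨ coeff-neg ((a ∷ p) *ₚ q) (suc i) ⟨
        coeff (-ₚ ((a ∷ p) *ₚ q)) (suc i)
          ∎ }
    where open ≈-Reasoning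

  ·ₚ-*ₚ-assoc : ∀ a q r → (a ·ₚ q) *ₚ r ≋ a ·ₚ (q *ₚ r)
  ·ₚ-*ₚ-assoc a []      r = ≋-refl
  ·ₚ-*ₚ-assoc a (b ∷ q) r = coeffwise λ
    { zero → begin
        coeff ((a ·ₚ (b ∷ q)) *ₚ r) 0    ≈⟨ coeff-∷*ₚ-zero (a * b) (a ·ₚ q) r ⟩
        (a * b) * coeff r 0              ≈⟨ *-assoc a b _ ⟩
        a * (b * coeff r 0)              ≈⟨ *-congˡ (coeff-∷*ₚ-zero b q r) ⟨
        a * coeff ((b ∷ q) *ₚ r) 0       ≈⟨ coeff-·ₚ a ((b ∷ q) *ₚ r) 0 ⟨
        coeff (a ·ₚ ((b ∷ q) *ₚ r)) 0    ∎
    ; (suc i) → begin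
        coeff ((a ·ₚ (b ∷ q)) *ₚ r) (suc i)
          ≈⟨ coeff-∷*ₚ-suc (a * b) (a ·ₚ q) r i ⟩
        (a * b) * coeff r (suc i) + coeff ((a ·ₚ q) *ₚ r) i
          ≈⟨ +-congˡ (trans (coeff-≈ (·ₚ-*ₚ-assoc a q r) i) (coeff-·ₚ a (q *ₚ r) i)) ⟩
        (a * b) * coeff r (suc i) + a * coeff (q *ₚ r) i
          ≈⟨ +-congʳ (*-assoc a b _) ⟩
        a * (b * coeff r (suc i)) + a * coeff (q *ₚ r) i
          ≈⟨ distribˡ a _ _ ⟨
        a * (b * coeff r (suc i) + coeff (q *ₚ r) i)
          ≈⟨ *-congˡ (coeff-∷*ₚ-suc b q r i) ⟨
        a * coeff ((b ∷ q) *ₚ r) (suc i)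
          ≈⟨ coeff-·ₚ a ((b ∷ q) *ₚ r) (suc i) ⟨
        coeff (a ·ₚ ((b ∷ q) *ₚ r)) (suc i)
          ∎ }
    where open ≈-Reasoning

  0∷-*ₚ : ∀ p r → (0# ∷ p) *ₚ r ≋ 0# ∷ (p *ₚ r)
  0∷-*ₚ p r = coeffwise λ
    { zero    → trans (coeff-∷*ₚ-zero 0# p r) (zeroˡ _)
    ; (suc i) → trans (coeff-∷*ₚ-suc 0# p r i) (trans (+-congʳ (zeroˡ _)) (+-identityˡ _)) }

  *ₚ-assoc : ∀ p q r → (p *ₚ q) *ₚ r ≋ p *ₚ (q *ₚ r)
  *ₚ-assoc []      q r = ≋-refl
  *ₚ-assoc (a ∷ p) q r = begin
    ((a ·ₚ q) +ₚ (0# ∷ (p *ₚ q))) *ₚ r             ≈⟨ *ₚ-distribʳ (a ·ₚ q) _ r ⟩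
    ((a ·ₚ q) *ₚ r) +ₚ ((0# ∷ (p *ₚ q)) *ₚ r)      ≈⟨ +ₚ-cong (·ₚ-*ₚ-assoc a q r) (0∷-*ₚ (p *ₚ q) r) ⟩
    (a ·ₚ (q *ₚ r)) +ₚ (0# ∷ ((p *ₚ q) *ₚ r))      ≈⟨ +ₚ-cong ≋-refl (∷-cong refl (*ₚ-assoc p q r)) ⟩
    (a ·ₚ (q *ₚ r)) +ₚ (0# ∷ (p *ₚ (q *ₚ r)))      ∎
    where open ≋-Reasoning

  coeff-const*ₚ : ∀ a q i → coeff (const a *ₚ q) i ≈ a * coeff q i
  coeff-const*ₚ a q i =
    trans (coeff-+ₚ (a ·ₚ q) (0# ∷ []) i) (trans (+-congˡ (coeff-≈ (0∷≋[] ≋-refl) i))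
                                          (trans (+-identityʳ _) (coeff-·ₚ a q i)))

  X^-+ : ∀ m n → X^ m *ₚ X^ n ≋ X^ (m ℕ.+ n)
  X^-+ zero    n = coeffwise λ i → trans (coeff-const*ₚ 1# (X^ n) i) (*-identityˡ _)
  X^-+ (suc m) n = ≋-trans (*ₚ-assoc X (X^ m) (X^ n)) (*ₚ-congʳ X _ _ (X^-+ m n))

  binomial-cong : ∀ n {λ′ μ} → λ′ ≈ μ → binomial n λ′ ≋ binomial n μ
  binomial-cong n λ′≈μ = +ₚ-cong ≋-refl (-ₚ-cong (∷-cong λ′≈μ ≋-refl))

  binomial-+-shift : ∀ m n λ′ → binomial (m ℕ.+ n) λ′ -ₚ (binomial m 1# *ₚ X^ n) ≋ binomial n λ′
  binomial-+-shift m n λ′ = coeffwise λ i → begin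
    coeff (binomial (m ℕ.+ n) λ′ -ₚ (binomial m 1# *ₚ X^ n)) i
      ≈⟨ coeff--ₚ (binomial (m ℕ.+ n) λ′) _ i ⟩
    coeff (binomial (m ℕ.+ n) λ′) i - coeff (binomial m 1# *ₚ X^ n) i
      ≈⟨ +-cong (coeff-+ₚ (X^ (m ℕ.+ n)) _ i) (-‿cong (coeff-binomial*X^ i)) ⟩
    (coeff (X^ (m ℕ.+ n)) i + coeff (-ₚ const λ′) i) - (coeff (X^ (m ℕ.+ n)) i - coeff (X^ n) i)
      ≈⟨ [y+l]-[y-z]≈z+l _ _ _ ⟩
    coeff (X^ n) i + coeff (-ₚ const λ′) i
      ≈⟨ coeff-+ₚ (X^ n) _ i ⟨
    coeff (binomial n λ′) i
      ∎
    where
    open ≈-Reasoning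
    coeff-binomial*X^ : ∀ i → coeff (binomial m 1# *ₚ X^ n) i ≈ coeff (X^ (m ℕ.+ n)) i - coeff (X^ n) i
    coeff-binomial*X^ i = begin
      coeff (binomial m 1# *ₚ X^ n) i
        ≈⟨ coeff-≈ (*ₚ-distribʳ (X^ m) (const (- 1#)) (X^ n)) i ⟩
      coeff ((X^ m *ₚ X^ n) +ₚ (const (- 1#) *ₚ X^ n)) i
        ≈⟨ coeff-+ₚ (X^ m *ₚ X^ n) _ i ⟩
      coeff (X^ m *ₚ X^ n) i + coeff (const (- 1#) *ₚ X^ n) i
        ≈⟨ +-cong (coeff-≈ (X^-+ m n) i) (trans (coeff-const*ₚ (- 1#) (X^ n) i) (-1*x≈-x _)) ⟩
      coeff (X^ (m ℕ.+ n)) i - coeff (X^ n) i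
        ∎

  ∣ₚ-respʳ : ∀ {f g h} → f ∣ₚ g → g ≋ h → f ∣ₚ h
  ∣ₚ-respʳ {f} {g} (k , fk≈g) g≋h = k , ≋⇒≈ₚ (≋-trans (≈ₚ⇒≋ {f *ₚ k} {g} fk≈g) g≋h)

  ∣ₚ-*ʳ : ∀ {f g} h → f ∣ₚ g → f ∣ₚ (g *ₚ h)
  ∣ₚ-*ʳ {f} {g} h (k , fk≈g) = k *ₚ h , ≋⇒≈ₚ (begin
    f *ₚ (k *ₚ h)   ≈⟨ *ₚ-assoc f k h ⟨
    (f *ₚ k) *ₚ h   ≈⟨ *ₚ-congˡ (f *ₚ k) g h (≈ₚ⇒≋ {f *ₚ k} {g} fk≈g) ⟩
    g *ₚ h          ∎)
    where open ≋-Reasoning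

  ∣ₚ-trans : ∀ {f g h} → f ∣ₚ g → g ∣ₚ h → f ∣ₚ h
  ∣ₚ-trans {f} {g} {h} f∣g (k , gk≈h) =
    ∣ₚ-respʳ {f} {g *ₚ k} (∣ₚ-*ʳ {f} {g} k f∣g) (≈ₚ⇒≋ {g *ₚ k} {h} gk≈h)

  ∣ₚ-- : ∀ {f g h} → f ∣ₚ g → f ∣ₚ h → f ∣ₚ (g -ₚ h)
  ∣ₚ-- {f} {g} {h} (k , fk≈g) (k′ , fk′≈h) = k -ₚ k′ , ≋⇒≈ₚ (begin
    f *ₚ (k -ₚ k′)               ≈⟨ *ₚ-distribˡ f k (-ₚ k′) ⟩
    (f *ₚ k) +ₚ (f *ₚ (-ₚ k′))   ≈⟨ +ₚ-cong ≋-refl (*ₚ-negʳ f k′) ⟩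
    (f *ₚ k) -ₚ (f *ₚ k′)        ≈⟨ +ₚ-cong (≈ₚ⇒≋ {f *ₚ k} {g} fk≈g) (-ₚ-cong (≈ₚ⇒≋ {f *ₚ k′} {h} fk′≈h)) ⟩
    g -ₚ h                       ∎)
    where open ≋-Reasoning

  ∣binomial-+⇒∣binomial : ∀ {f} m n λ′ → f ∣ₚ binomial m 1# →
                          f ∣ₚ binomial (m ℕ.+ n) λ′ → f ∣ₚ binomial n λ′
  ∣binomial-+⇒∣binomial {f} m n λ′ f∣Xᵐ-1 f∣Xᵐ⁺ⁿ-λ =
    ∣ₚ-respʳ {f} (∣ₚ-- {f} f∣Xᵐ⁺ⁿ-λ (∣ₚ-*ʳ {f} (X^ n) f∣Xᵐ-1)) (binomial-+-shift m n λ′)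

  HasLeadingCoeff : Pol → ℕ → Carrier → Set ℓ
  HasLeadingCoeff p d a = coeff p d ≈ a × (∀ i → d < i → coeff p i ≈ 0#)

  ≋[]⊎HasLeadingCoeff : ∀ p → p ≋ [] ⊎ ∃₂ λ d a → ¬ a ≈ 0# × HasLeadingCoeff p d a
  ≋[]⊎HasLeadingCoeff []      = inj₁ ≋-refl
  ≋[]⊎HasLeadingCoeff (a ∷ p) with ≋[]⊎HasLeadingCoeff p
  ... | inj₂ (d , b , b≉0 , p[d]≈b , above) =
    inj₂ (suc d , b , b≉0 , p[d]≈b , λ { zero () ; (suc i) (s≤s d<i) → above i d<i })
  ... | inj₁ p≋[] with a ≟ 0#
  ...   | yes a≈0 = inj₁ (coeffwise λ { zero → a≈0 ; (suc i) → coeff-≈ p≋[] i })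
  ...   | no  a≉0 = inj₂ (0 , a , a≉0 , refl , λ { zero () ; (suc i) _ → coeff-≈ p≋[] i })

  *ₚ-HasLeadingCoeff : ∀ p {q d e a b} → HasLeadingCoeff p d a → HasLeadingCoeff q e b →
                       HasLeadingCoeff (p *ₚ q) (d ℕ.+ e) (a * b)
  *ₚ-HasLeadingCoeff [] {b = b} (0≈a , _) _ = trans (sym (zeroˡ b)) (*-congʳ 0≈a) , λ _ _ → refl
  *ₚ-HasLeadingCoeff (a′ ∷ p) {q} {zero} (a′≈a , above) (q[e]≈b , q-above) =
    trans (coeff-product _) (*-cong a′≈a q[e]≈b) ,
    λ i e<i → trans (coeff-product i) (trans (*-congˡ (q-above i e<i)) (zeroʳ a′))
    where
    coeff-product : ∀ i → coeff ((a′ ∷ p) *ₚ q) i ≈ a′ * coeff q i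
    coeff-product i =
      trans (coeff-≈ (*ₚ-congˡ (a′ ∷ p) (const a′) q (∷-cong refl (coeffwise λ j → above (suc j) (s≤s z≤n)))) i)
            (coeff-const*ₚ a′ q i)
  *ₚ-HasLeadingCoeff (a′ ∷ p) {q} {suc d} {e} {a} {b} (p[d]≈a , above) q-lead@(_ , q-above) =
    trans (coeff-∷*ₚ-suc a′ p q (d ℕ.+ e)) (trans (+-cong (a′*q[i]≈0 e≤d+e) (proj₁ pq-lead)) (+-identityˡ _)) ,
    λ { zero () ; (suc i) (s≤s d+e<i) →
          trans (coeff-∷*ₚ-suc a′ p q i)
                (trans (+-cong (a′*q[i]≈0 (≤-trans e≤d+e (<⇒≤ d+e<i))) (proj₂ pq-lead i d+e<i)) (+-identityˡ _)) }
    where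
    e≤d+e : e ≤ d ℕ.+ e
    e≤d+e = m≤n+m e d
    a′*q[i]≈0 : ∀ {i} → e ≤ i → a′ * coeff q (suc i) ≈ 0#
    a′*q[i]≈0 e≤i = trans (*-congˡ (q-above _ (s≤s e≤i))) (zeroʳ a′)
    pq-lead : HasLeadingCoeff (p *ₚ q) (d ℕ.+ e) (a * b)
    pq-lead = *ₚ-HasLeadingCoeff p (p[d]≈a , λ i d<i → above (suc i) (s≤s d<i)) q-lead

  ∣nonzero-const⇒IsConstant : ∀ f {b} → ¬ b ≈ 0# → f ∣ₚ const b → IsConstant f
  ∣nonzero-const⇒IsConstant f {b} b≉0 (k , fk≈b)
    with ≈ₚ⇒≋ {f *ₚ k} {const b} fk≈b | ≋[]⊎HasLeadingCoeff f | ≋[]⊎HasLeadingCoeff k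
  ... | _ | inj₁ f≋[] | _ = 0# , ≋⇒≈ₚ (≋-trans f≋[] (≋-sym (0∷≋[] ≋-refl)))
  ... | fk≋b | inj₂ _ | inj₁ k≋[] =
    ⊥-elim (b≉0 (trans (sym (coeff-≈ fk≋b 0))
                       (coeff-≈ (≋-trans (*ₚ-congʳ f k [] k≋[]) (*ₚ-zeroʳ f)) 0)))
  ... | _ | inj₂ (zero , _ , _ , _ , above) | inj₂ _ =
    coeff f 0 , ≋⇒≈ₚ {f} {const (coeff f 0)} (coeffwise λ { zero → refl ; (suc i) → above (suc i) (s≤s z≤n) })
  ... | fk≋b | inj₂ (suc d , a , a≉0 , f-lead) | inj₂ (e , c , c≉0 , k-lead) =
    ⊥-elim (*-nonzero a≉0 c≉0 (trans (sym (proj₁ (*ₚ-HasLeadingCoeff f f-lead k-lead)))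
                                     (coeff-≈ fk≋b (suc (d ℕ.+ e)))))

  ∣binomial⇒∣1-λ : ∀ {f e λ′} → IsOrder f e → FreeOfBinomials f → ¬ λ′ ≈ 0# →
                   ∀ n → f ∣ₚ binomial n λ′ → f ∣ₚ const (1# - λ′)
  ∣binomial⇒∣1-λ {f} {e} {λ′} ord@(1≤e , f∣Xᵉ-1 , _) free λ′≉0 = <-rec _ reduce
    where
    reduce : ∀ n → (∀ {r} → r < n → f ∣ₚ binomial r λ′ → f ∣ₚ const (1# - λ′)) →
             f ∣ₚ binomial n λ′ → f ∣ₚ const (1# - λ′)
    -- binomial 0 λ′ reduces to const (1# - λ′)
    reduce zero    _   f∣1-λ = f∣1-λ
    reduce (suc n) rec f∣Xⁿ-λ with suc n <? e
    ... | yes n<e = ⊥-elim (free e ord (suc n) λ′ (s≤s z≤n) n<e λ′≉0 f∣Xⁿ-λ)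
    ... | no  n≮e with m≤n⇒∃[o]m+o≡n (≮⇒≥ n≮e)
    ...   | r , e+r≡n = rec (≡.subst (r <_) e+r≡n (m<n+m r 1≤e))
                            (∣binomial-+⇒∣binomial {f} e r λ′ f∣Xᵉ-1
                               (≡.subst (λ k → f ∣ₚ binomial k λ′) (≡.sym e+r≡n) f∣Xⁿ-λ))

  FreeOfBinomials⇒∤binomial : ∀ {f e} → NonConstant f → FreeOfBinomials f → IsOrder f e →
                              ∀ n {λ′} → ¬ λ′ ≈ 0# → ¬ λ′ ≈ 1# → ¬ f ∣ₚ binomial n λ′
  FreeOfBinomials⇒∤binomial {f} f-nonconst free ord n {λ′} λ′≉0 λ′≉1 f∣Xⁿ-λ =
    f-nonconst (∣nonzero-const⇒IsConstant f 1-λ′≉0 (∣binomial⇒∣1-λ {f} ord free λ′≉0 n f∣Xⁿ-λ))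
    where
    1-λ′≉0 : ¬ 1# - λ′ ≈ 0#
    1-λ′≉0 1-λ′≈0 = λ′≉1 (sym (x∙y⁻¹≈ε⇒x≈y 1# λ′ 1-λ′≈0))

  ¬¬-∃-IsOrder : ∀ {f m} → 1 ≤ m → f ∣ₚ binomial m 1# → ¬ ¬ ∃ (IsOrder f)
  ¬¬-∃-IsOrder {f} 1≤m f∣Xᵐ-1 = ¬¬-map
    (λ (e , (1≤e , f∣Xᵉ-1) , least) → e , 1≤e , f∣Xᵉ-1 , λ k 1≤k f∣Xᵏ-1 → least k (1≤k , f∣Xᵏ-1))
    (¬¬-least (λ k → 1 ≤ k × f ∣ₚ binomial k 1#) (1≤m , f∣Xᵐ-1))

  ∣⇒FreeOfBinomials : ∀ {f l} → NonConstant f → FreeOfBinomials f → f ∣ₚ l → FreeOfBinomials l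
  ∣⇒FreeOfBinomials {f} {l} f-nonconst f-free f∣l m (1≤m , l∣Xᵐ-1 , m-least) n λ′ 1≤n n<m λ′≉0 l∣Xⁿ-λ
    with λ′ ≟ 1#
  ... | yes λ′≈1 = <⇒≱ n<m (m-least n 1≤n (∣ₚ-respʳ {l} l∣Xⁿ-λ (binomial-cong n λ′≈1)))
  ... | no  λ′≉1 = ¬¬-∃-IsOrder {f} 1≤m (∣ₚ-trans {f} f∣l l∣Xᵐ-1) λ (e , ord) →
    FreeOfBinomials⇒∤binomial {f} f-nonconst f-free ord n λ′≉0 λ′≉1 (∣ₚ-trans {f} f∣l l∣Xⁿ-λ)

corollary3 : ∀ {c ℓ} (F : FiniteField c ℓ) → let open Poly F in
    ∀ (f₁ f₂ : Pol) →
    NonConstant f₁ → NonConstant f₂ →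
    Squarefree f₁ → Squarefree f₂ →
    Coprime f₁ X → Coprime f₂ X →
    FreeOfBinomials f₁ → FreeOfBinomials f₂ →
    ∀ (l : Pol) → IsLCM f₁ f₂ l → FreeOfBinomials l
corollary3 F f₁ f₂ f₁-nonconst _ _ _ _ _ f₁-free _ l (f₁∣l , _) =
  Polynomials.∣⇒FreeOfBinomials F f₁-nonconst f₁-free f₁∣l
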